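{- Let $G$ be a finite, simple, undirected, connected graph with at least two vertices, and let $x_1,x_2,x_3$ be any three vertices of $G$. Then $$\gamma(G) \ge \frac{1}{6}\bigl(d_G(x_1, x_2)+d_G(x_1, x_3)+d_G(x_2, x_3)\bigr).$$ Further, if equality holds, then $d_G(u, v)\equiv 2 \pmod 3$ for every pair $u,v\in\{x_1,x_2,x_3\}$.
   Context: A set $S\subseteq V(G)$ is a dominating set of $G$ if every vertex of $G$ either belongs to $S$ or is adjacent to a vertex of $S$. The domination number $\gamma(G)$ is the minimum cardinality of a dominating set of $G$. $d_G(x,y)$ denotes the length of a shortest $x$–$y$ path in $G$. -}

module Defs where

open import Data.Nat using (ℕ; zero; suc; _≤_)
open import Data.Fin using (Fin)
open import Data.Fin.Subset using (Subset; _∈_; ∣_∣)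
open import Data.Product using (Σ; ∃; _×_; _,_)
open import Data.Sum using (_⊎_)
open import Relation.Nullary using (¬_)
open import Relation.Binary.PropositionalEquality using (_≡_)

record Graph (n : ℕ) : Set₁ where
  field
    Adj     : Fin n → Fin n → Set
    irrefl  : ∀ x → ¬ Adj x x
    sym     : ∀ {x y} → Adj x y → Adj y x
open Graph public

data Walk {n : ℕ} (G : Graph n) : ℕ → Fin n → Fin n → Set where
  here : ∀ {x} → Walk G zero x x
  step : ∀ {k x y z} → Adj G x y → Walk G k y z → Walk G (suc k) x z

Connected : ∀ {n} → Graph n → Set
Connected G = ∀ x y → ∃ λ k → Walk G k x y

IsDistance : ∀ {n} → Graph n → Fin n → Fin n → ℕ → Set
IsDistance G x y k = Walk G k x y × (∀ m → Walk G m x y → k ≤ m)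

Dominating : ∀ {n} → Graph n → Subset n → Set
Dominating G S = ∀ v → v ∈ S ⊎ (∃ λ u → u ∈ S × Adj G v u)

IsDominationNumber : ∀ {n} → Graph n → ℕ → Set
IsDominationNumber G g =
  (∃ λ S → Dominating G S × ∣ S ∣ ≡ g) × (∀ S → Dominating G S → g ≤ ∣ S ∣)

-- Let S be a minimum dominating set and call two vertices of S neighbours in an
-- auxiliary graph H when they are at distance at most 3 in G.  H is connected,
-- since along any path of G every vertex is dominated by some vertex of S.  Growing
-- a subset T of S one H-neighbour at a time, we maintain that any three vertices of
-- T are joined to a common centre by H-walks of lengths h₁, h₂, h₃ with
-- h₁ + h₂ + h₃ < ∣ T ∣.  Taking T = S and sᵢ a dominator of xᵢ, we get
-- d(xᵢ, xⱼ) ≤ 2 + 3 (hᵢ + hⱼ), and these three bounds sum to 6 (h₁ + h₂ + h₃ + 1) ≤ 6γ;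
-- equality forces d(xᵢ, xⱼ) = 2 + 3 (hᵢ + hⱼ).
module Submission where

open import Defs
open import Data.Nat using (ℕ; suc; _≤_; _<_; _+_; _*_; _%_; z≤n; s≤s; z<s)
open import Data.Nat.Properties
open import Data.Nat.DivMod using ([m+kn]%n≡m%n)
open import Data.Nat.Induction using (<-wellFounded)
open import Data.Nat.Tactic.RingSolver using (solve-∀)
open import Algebra.Properties.CommutativeSemigroup +-commutativeSemigroup
  using (xy∙z≈yx∙z; xy∙z≈xz∙y)
open import Data.Fin using (Fin)
open import Data.Fin.Subset using (Subset; inside; _∈_; _∉_; _⊆_; _⊂_; ∣_∣; ⁅_⁆; _∪_; _─_)
open import Data.Fin.Subset.Properties
open import Data.Vec using (_∷_; here; there)
open import Data.Product using (∃; _×_; _,_; proj₁)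
open import Data.Sum using (_⊎_; inj₁; inj₂)
open import Induction.WellFounded using (Acc; acc)
open import Relation.Nullary using (yes; no; contradiction)
open import Relation.Binary.PropositionalEquality as ≡ using (_≡_; refl; subst)

≤-tight : ∀ {a A b B} → a ≤ A → b ≤ B → A + B ≤ a + b → a ≡ A × b ≡ B
≤-tight a≤A b≤B A+B≤a+b =
  ≤∧≮⇒≡ a≤A (λ a<A → <⇒≱ (+-mono-<-≤ a<A b≤B) A+B≤a+b) ,
  ≤∧≮⇒≡ b≤B (λ b<B → <⇒≱ (+-mono-≤-< a≤A b<B) A+B≤a+b)

≤-tight₃ : ∀ {a A b B c C} → a ≤ A → b ≤ B → c ≤ C → A + B + C ≤ a + b + c →
           a ≡ A × b ≡ B × c ≡ C
≤-tight₃ a≤A b≤B c≤C sum≤ with ≤-tight (+-mono-≤ a≤A b≤B) c≤C sum≤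
... | a+b≡A+B , c≡C with ≤-tight a≤A b≤B (≤-reflexive (≡.sym a+b≡A+B))
...   | a≡A , b≡B = a≡A , b≡B , c≡C

[2+3k]%3≡2 : ∀ k → (2 + 3 * k) % 3 ≡ 2
[2+3k]%3≡2 k = subst (λ m → (2 + m) % 3 ≡ 2) (*-comm k 3) ([m+kn]%n≡m%n 2 k 3)

distance-sum-bound : ∀ {a b c g d₁₂ d₁₃ d₂₃} → a + b + c < g →
  d₁₂ ≤ 2 + 3 * (a + b) → d₁₃ ≤ 2 + 3 * (a + c) → d₂₃ ≤ 2 + 3 * (b + c) →
  (d₁₂ + d₁₃ + d₂₃ ≤ 6 * g)
  × (6 * g ≡ d₁₂ + d₁₃ + d₂₃ → (d₁₂ % 3 ≡ 2) × (d₁₃ % 3 ≡ 2) × (d₂₃ % 3 ≡ 2))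
distance-sum-bound {a} {b} {c} {g} {d₁₂} {d₁₃} {d₂₃} a+b+c<g d₁₂≤ d₁₃≤ d₂₃≤ =
  ≤-trans (+-mono-≤ (+-mono-≤ d₁₂≤ d₁₃≤) d₂₃≤) bounds≤6g , equality
  where
  bounds : ℕ
  bounds = (2 + 3 * (a + b)) + (2 + 3 * (a + c)) + (2 + 3 * (b + c))

  bounds≤6g : bounds ≤ 6 * g
  bounds≤6g = begin
    bounds               ≡⟨ bounds-sum a b c ⟩
    6 * suc (a + b + c)  ≤⟨ *-monoʳ-≤ 6 a+b+c<g ⟩
    6 * g                ∎
    where
    open ≤-Reasoning
    bounds-sum : ∀ a b c →
      (2 + 3 * (a + b)) + (2 + 3 * (a + c)) + (2 + 3 * (b + c)) ≡ 6 * suc (a + b + c)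
    bounds-sum = solve-∀

  equality : 6 * g ≡ d₁₂ + d₁₃ + d₂₃ → (d₁₂ % 3 ≡ 2) × (d₁₃ % 3 ≡ 2) × (d₂₃ % 3 ≡ 2)
  equality 6g≡ with ≤-tight₃ d₁₂≤ d₁₃≤ d₂₃≤ (subst (bounds ≤_) 6g≡ bounds≤6g)
  ... | refl , refl , refl = [2+3k]%3≡2 (a + b) , [2+3k]%3≡2 (a + c) , [2+3k]%3≡2 (b + c)

module _ {n : ℕ} where

  x∈⁅y⁆∪p⁻ : ∀ {x y : Fin n} {p} → x ∈ ⁅ y ⁆ ∪ p → x ≡ y ⊎ x ∈ p
  x∈⁅y⁆∪p⁻ {y = y} {p} x∈ with x∈p∪q⁻ ⁅ y ⁆ p x∈
  ... | inj₁ x∈⁅y⁆ = inj₁ (x∈⁅y⁆⇒x≡y y x∈⁅y⁆)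
  ... | inj₂ x∈p   = inj₂ x∈p

  ⁅x⁆∪p⊆q : ∀ {x : Fin n} {p q} → x ∈ q → p ⊆ q → ⁅ x ⁆ ∪ p ⊆ q
  ⁅x⁆∪p⊆q x∈q p⊆q y∈ with x∈⁅y⁆∪p⁻ y∈
  ... | inj₁ refl = x∈q
  ... | inj₂ y∈p  = p⊆q y∈p

  p⊂⁅x⁆∪p : ∀ {x : Fin n} {p} → x ∉ p → p ⊂ ⁅ x ⁆ ∪ p
  p⊂⁅x⁆∪p {x} {p} x∉p = q⊆p∪q ⁅ x ⁆ p , x , x∈p∪q⁺ (inj₁ (x∈⁅x⁆ x)) , x∉p

x∈p─q⇒x∉q : ∀ {n} {x : Fin n} {p q : Subset n} → x ∈ p ─ q → x ∉ q
x∈p─q⇒x∉q {p = _ ∷ _} {inside ∷ _} ()  here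
x∈p─q⇒x∉q {p = _ ∷ _} {_ ∷ _} (there x∈p─q) (there x∈q) = x∈p─q⇒x∉q x∈p─q x∈q

∣p─⁅x⁆∪q∣<∣p─q∣ : ∀ {n} {x : Fin n} {p q} → x ∈ p → x ∉ q → ∣ p ─ (⁅ x ⁆ ∪ q) ∣ < ∣ p ─ q ∣
∣p─⁅x⁆∪q∣<∣p─q∣ {x = x} {p} {q} x∈p x∉q =
  subst (λ r → ∣ r ∣ < ∣ p ─ q ∣) p-q-x≡p-[x∪q] (x∈p⇒∣p-x∣<∣p∣ (x∈p∧x∉q⇒x∈p─q x∈p x∉q))
  where
  p-q-x≡p-[x∪q] : p ─ q ─ ⁅ x ⁆ ≡ p ─ (⁅ x ⁆ ∪ q)
  p-q-x≡p-[x∪q] = ≡.trans (p─q─r≡p─r─q p q ⁅ x ⁆) (p─q─r≡p─q∪r p ⁅ x ⁆ q)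

module MetricTripods {n : ℕ} (R : ℕ → Fin n → Fin n → Set)
  (R-refl  : ∀ {x} → R 0 x x)
  (R-sym   : ∀ {h x y} → R h x y → R h y x)
  (R-trans : ∀ {h h′ x y z} → R h x y → R h′ y z → R (h + h′) x z)
  where

  record Tripod (t : ℕ) (a b c : Fin n) : Set where
    constructor tripod
    field
      {centre}   : Fin n
      {h₁ h₂ h₃} : ℕ
      leg₁       : R h₁ a centre
      leg₂       : R h₂ b centre
      leg₃       : R h₃ c centre
      weight<    : h₁ + h₂ + h₃ < t

  Tripod-≤ : ∀ {t t′ a b c} → t ≤ t′ → Tripod t a b c → Tripod t′ a b c
  Tripod-≤ t≤t′ (tripod l₁ l₂ l₃ w<) = tripod l₁ l₂ l₃ (<-≤-trans w< t≤t′)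

  Tripod-swap₁₂ : ∀ {t a b c} → Tripod t a b c → Tripod t b a c
  Tripod-swap₁₂ {t} (tripod {h₁ = h₁} {h₂} {h₃} l₁ l₂ l₃ w<) =
    tripod l₂ l₁ l₃ (subst (_< t) (xy∙z≈yx∙z h₁ h₂ h₃) w<)

  Tripod-swap₂₃ : ∀ {t a b c} → Tripod t a b c → Tripod t a c b
  Tripod-swap₂₃ {t} (tripod {h₁ = h₁} {h₂} {h₃} l₁ l₂ l₃ w<) =
    tripod l₁ l₃ l₂ (subst (_< t) (xy∙z≈xz∙y h₁ h₂ h₃) w<)

  Tripod-extend : ∀ {t a′ a b c} → R 1 a′ a → Tripod t a b c → Tripod (suc t) a′ b c
  Tripod-extend a′a (tripod l₁ l₂ l₃ w<) = tripod (R-trans a′a l₁) l₂ l₃ (s≤s w<)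

  Tripod-degenerate : ∀ {t h a c} → R h c a → h < t → Tripod t a a c
  Tripod-degenerate ca h<t = tripod R-refl R-refl ca h<t

  Tripod-paths : ∀ {t a b c} (τ : Tripod t a b c) → let open Tripod τ in
    R (h₁ + h₂) a b × R (h₁ + h₃) a c × R (h₂ + h₃) b c
  Tripod-paths (tripod l₁ l₂ l₃ _) =
    R-trans l₁ (R-sym l₂) , R-trans l₁ (R-sym l₃) , R-trans l₂ (R-sym l₃)

  Tripod-path₁₂ : ∀ {t a b c} → Tripod t a b c → ∃ λ h → R h a b × h < t
  Tripod-path₁₂ τ@(tripod {h₁ = h₁} {h₂} _ _ _ w<) =
    h₁ + h₂ , proj₁ (Tripod-paths τ) , ≤-<-trans (m≤m+n (h₁ + h₂) _) w<

  Tripods : Subset n → ℕ → Set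
  Tripods T t = ∀ {a b c} → a ∈ T → b ∈ T → c ∈ T → Tripod t a b c

  Tripods-≤ : ∀ {T t t′} → t ≤ t′ → Tripods T t → Tripods T t′
  Tripods-≤ t≤t′ tT a∈ b∈ c∈ = Tripod-≤ t≤t′ (tT a∈ b∈ c∈)

  Tripods-⊆ : ∀ {S T t} → S ⊆ T → Tripods T t → Tripods S t
  Tripods-⊆ S⊆T tT a∈ b∈ c∈ = tT (S⊆T a∈) (S⊆T b∈) (S⊆T c∈)

  Tripods-⁅⁆ : ∀ {s} → Tripods ⁅ s ⁆ 1
  Tripods-⁅⁆ {s} a∈ b∈ c∈ with x∈⁅y⁆⇒x≡y s a∈ | x∈⁅y⁆⇒x≡y s b∈ | x∈⁅y⁆⇒x≡y s c∈
  ... | refl | refl | refl = Tripod-degenerate R-refl z<s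

  Tripods-insert : ∀ {T t u v} → Tripods T t → u ∈ T → R 1 u v → Tripods (⁅ v ⁆ ∪ T) (suc t)
  Tripods-insert {T} {t} {u} {v} tT u∈T uv a∈ b∈ c∈ =
    by-cases (x∈⁅y⁆∪p⁻ a∈) (x∈⁅y⁆∪p⁻ b∈) (x∈⁅y⁆∪p⁻ c∈)
    where
    vu : R 1 v u
    vu = R-sym uv

    twice-v : ∀ {c} → c ∈ T → Tripod (suc t) v v c
    twice-v c∈T with Tripod-path₁₂ (tT u∈T c∈T c∈T)
    ... | _ , uc , h<t = Tripod-degenerate (R-sym (R-trans vu uc)) (s≤s h<t)

    by-cases : ∀ {a b c} → a ≡ v ⊎ a ∈ T → b ≡ v ⊎ b ∈ T → c ≡ v ⊎ c ∈ T →
               Tripod (suc t) a b c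
    by-cases (inj₂ a∈T) (inj₂ b∈T) (inj₂ c∈T) = Tripod-≤ (n≤1+n t) (tT a∈T b∈T c∈T)
    by-cases (inj₁ refl) (inj₂ b∈T) (inj₂ c∈T) = Tripod-extend vu (tT u∈T b∈T c∈T)
    by-cases (inj₂ a∈T) (inj₁ refl) (inj₂ c∈T) =
      Tripod-swap₁₂ (Tripod-extend vu (tT u∈T a∈T c∈T))
    by-cases (inj₂ a∈T) (inj₂ b∈T) (inj₁ refl) =
      Tripod-swap₂₃ (Tripod-swap₁₂ (Tripod-extend vu (tT u∈T a∈T b∈T)))
    by-cases (inj₁ refl) (inj₁ refl) (inj₂ c∈T) = twice-v c∈T
    by-cases (inj₁ refl) (inj₂ b∈T) (inj₁ refl) = Tripod-swap₂₃ (twice-v b∈T)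
    by-cases (inj₂ a∈T) (inj₁ refl) (inj₁ refl) = Tripod-swap₁₂ (Tripod-swap₂₃ (twice-v a∈T))
    by-cases (inj₁ refl) (inj₁ refl) (inj₁ refl) = Tripod-degenerate R-refl z<s

  record Bridge (S T : Subset n) : Set where
    constructor bridge
    field
      {from to} : Fin n
      from∈T    : from ∈ T
      to∈S      : to ∈ S
      to∉T      : to ∉ T
      hop       : R 1 from to

  Linked : Subset n → Set
  Linked S = ∀ {T s x} → s ∈ T → x ∈ S → x ∉ T → Bridge S T

  Tripods-of-linked : ∀ {S s} → Linked S → s ∈ S → Tripods S ∣ S ∣
  Tripods-of-linked {S} {s} linked s∈S =
    grow ⁅ s ⁆ (x∈⁅x⁆ s) ⁅s⁆⊆S ⁅s⁆-tripods (<-wellFounded _)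
    where
    ⁅s⁆⊆S : ⁅ s ⁆ ⊆ S
    ⁅s⁆⊆S x∈⁅s⁆ = subst (_∈ S) (≡.sym (x∈⁅y⁆⇒x≡y s x∈⁅s⁆)) s∈S

    ⁅s⁆-tripods : Tripods ⁅ s ⁆ ∣ ⁅ s ⁆ ∣
    ⁅s⁆-tripods = subst (Tripods ⁅ s ⁆) (≡.sym (∣⁅x⁆∣≡1 s)) Tripods-⁅⁆

    grow : ∀ T → s ∈ T → T ⊆ S → Tripods T ∣ T ∣ → Acc _<_ ∣ S ─ T ∣ → Tripods S ∣ S ∣
    grow T s∈T T⊆S tT (acc smaller) with nonempty? (S ─ T)
    ... | no S─T-empty = Tripods-≤ (p⊆q⇒∣p∣≤∣q∣ T⊆S) (Tripods-⊆ S⊆T tT)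
      where
      S⊆T : S ⊆ T
      S⊆T {x} x∈S with x ∈? T
      ... | yes x∈T = x∈T
      ... | no  x∉T = contradiction (x , x∈p∧x∉q⇒x∈p─q x∈S x∉T) S─T-empty
    ... | yes (x , x∈S─T) with linked s∈T (p─q⊆p S T x∈S─T) (x∈p─q⇒x∉q x∈S─T)
    ...   | bridge {to = v} u∈T v∈S v∉T uv =
      grow (⁅ v ⁆ ∪ T) (q⊆p∪q ⁅ v ⁆ T s∈T) (⁅x⁆∪p⊆q v∈S T⊆S)
        (Tripods-≤ (p⊂q⇒∣p∣<∣q∣ (p⊂⁅x⁆∪p v∉T)) (Tripods-insert tT u∈T uv))
        (smaller (∣p─⁅x⁆∪q∣<∣p─q∣ v∈S v∉T))

module _ {n : ℕ} {G : Graph n} where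

  _++ʷ_ : ∀ {k l x y z} → Walk G k x y → Walk G l y z → Walk G (k + l) x z
  here       ++ʷ q = q
  step xy p  ++ʷ q = step xy (p ++ʷ q)

  reverse : ∀ {k x y} → Walk G k x y → Walk G k y x
  reverse here = here
  reverse {suc k} {x} {y} (step xy p) =
    subst (λ l → Walk G l y x) (+-comm k 1) (reverse p ++ʷ step (Graph.sym G xy) here)

module _ {n : ℕ} (G : Graph n) where

  record Within (k : ℕ) (x y : Fin n) : Set where
    constructor within
    field
      {len} : ℕ
      len≤  : len ≤ k
      walk  : Walk G len x y

module _ {n : ℕ} {G : Graph n} where

  Within-refl : ∀ {k x} → Within G k x x
  Within-refl = within z≤n here

  Within-edge : ∀ {x y} → Adj G x y → Within G 1 x y
  Within-edge xy = within ≤-refl (step xy here)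

  Within-sym : ∀ {k x y} → Within G k x y → Within G k y x
  Within-sym (within l≤k w) = within l≤k (reverse w)

  Within-trans : ∀ {k k′ x y z} → Within G k x y → Within G k′ y z → Within G (k + k′) x z
  Within-trans (within l≤k w) (within l′≤k′ w′) = within (+-mono-≤ l≤k l′≤k′) (w ++ʷ w′)

  Within-≤ : ∀ {k k′ x y} → k ≤ k′ → Within G k x y → Within G k′ x y
  Within-≤ k≤k′ (within l≤k w) = within (≤-trans l≤k k≤k′) w

  distance≤ : ∀ {k x y d} → IsDistance G x y d → Within G k x y → d ≤ k
  distance≤ (_ , minimal) (within l≤k w) = ≤-trans (minimal _ w) l≤k

  distance-via : ∀ {k x y s s′ d} → IsDistance G x y d →
    Within G 1 x s → Within G k s s′ → Within G 1 y s′ → d ≤ 2 + k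
  distance-via {k} {d = d} dist xs ss′ ys′ =
    subst (d ≤_) (+-comm (suc k) 1)
      (distance≤ dist (Within-trans (Within-trans xs ss′) (Within-sym ys′)))

  dominator : ∀ {S} → Dominating G S → ∀ x → ∃ λ s → s ∈ S × Within G 1 x s
  dominator dom x with dom x
  ... | inj₁ x∈S             = x , x∈S , Within-refl
  ... | inj₂ (s , s∈S , xs)  = s , s∈S , Within-edge xs

  -- A walk of length at most 3h stands in for h hops of the auxiliary graph;
  -- only the triangle inequalities of Hops are used.
  Hops : ℕ → Fin n → Fin n → Set
  Hops h = Within G (3 * h)

  Hops-trans : ∀ {h h′ x y z} → Hops h x y → Hops h′ y z → Hops (h + h′) x z
  Hops-trans {h} {h′} xy yz =
    Within-≤ (≤-reflexive (≡.sym (*-distribˡ-+ 3 h h′))) (Within-trans xy yz)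

  open MetricTripods Hops Within-refl Within-sym (λ {h} {h′} → Hops-trans {h} {h′}) public

  module _ {S : Subset n} (dom : Dominating G S) {T : Subset n} where

    bridge-along : ∀ {k y x d} → Walk G k y x → d ∈ T → Within G 1 d y →
                   x ∈ S → x ∉ T → Bridge S T
    bridge-along here d∈T dx x∈S x∉T = bridge d∈T x∈S x∉T (Within-≤ (s≤s z≤n) dx)
    bridge-along (step {y = y′} yy′ rest) d∈T dy x∈S x∉T with dominator dom y′
    ... | d′ , d′∈S , y′d′ with d′ ∈? T
    ...   | yes d′∈T = bridge-along rest d′∈T (Within-sym y′d′) x∈S x∉T
    ...   | no  d′∉T =
      bridge d∈T d′∈S d′∉T (Within-trans (Within-trans dy (Within-edge yy′)) y′d′)

  dominating-linked : ∀ {S} → Connected G → Dominating G S → Linked S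
  dominating-linked connected dom {s = s} {x} s∈T x∈S x∉T with connected s x
  ... | _ , sx = bridge-along dom sx s∈T Within-refl x∈S x∉T

theorem2 : ∀ {n} (G : Graph n) → 2 ≤ n → Connected G →
    (x₁ x₂ x₃ : Fin n) (γ d₁₂ d₁₃ d₂₃ : ℕ) →
    IsDominationNumber G γ →
    IsDistance G x₁ x₂ d₁₂ → IsDistance G x₁ x₃ d₁₃ → IsDistance G x₂ x₃ d₂₃ →
    (d₁₂ + d₁₃ + d₂₃ ≤ 6 * γ)
    × (6 * γ ≡ d₁₂ + d₁₃ + d₂₃ →
        (d₁₂ % 3 ≡ 2) × (d₁₃ % 3 ≡ 2) × (d₂₃ % 3 ≡ 2))
theorem2 G _ connected x₁ x₂ x₃ _ _ _ _ ((S , dom , refl) , _) dist₁₂ dist₁₃ dist₂₃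
  with dominator dom x₁ | dominator dom x₂ | dominator dom x₃
... | s₁ , s₁∈S , x₁s₁ | s₂ , s₂∈S , x₂s₂ | s₃ , s₃∈S , x₃s₃
  with Tripods-of-linked (dominating-linked connected dom) s₁∈S s₁∈S s₂∈S s₃∈S
...   | τ@(tripod {h₁ = h₁} {h₂} {h₃} _ _ _ weight<) =
  let s₁s₂ , s₁s₃ , s₂s₃ = Tripod-paths τ in
  distance-sum-bound {h₁} {h₂} {h₃} weight<
    (distance-via dist₁₂ x₁s₁ s₁s₂ x₂s₂)
    (distance-via dist₁₃ x₁s₁ s₁s₃ x₃s₃)
    (distance-via dist₂₃ x₂s₂ s₂s₃ x₃s₃)
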